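{- Let $\mathbf P$ be a matroid property stable under isomorphism. (1) If $\mathbf P$ is deletion closed and closed under direct sum with $U_{0,1}$, then $(\mathcal M^{\mathbf P}_\bullet,\partial^{\mathrm{tot}}_{\mathrm{del}})$, $(\mathcal M^{\mathbf P}_\bullet,\partial_{\mathrm{del}})$, and $(\mathcal M^{\mathbf P}_{\bullet,r},\partial_{\mathrm{del}})$ for all $r\ge0$ are acyclic. (2) If $\mathbf P$ is contraction closed and closed under direct sum with $U_{0,1}$, then $(\mathcal M^{\mathbf P}_\bullet,\partial^{\mathrm{tot}}_{\mathrm{con}})$, $(\mathcal M^{\mathbf P}_\bullet,\partial_{\mathrm{lp}})$, and $(\mathcal M^{\mathbf P}_{\bullet,r},\partial_{\mathrm{lp}})$ for all $r\ge0$ are acyclic. (3) If $\mathbf P$ is deletion closed and closed under direct sum with $U_{1,1}$, then $(\mathcal M^{\mathbf P}_\bullet,\partial^{\mathrm{tot}}_{\mathrm{del}})$, $(\mathcal M^{\mathbf P}_\bullet,\partial_{\mathrm{clp}})$, and $(\mathcal M^{\mathbf P}_{k,\bullet},\partial_{\mathrm{clp}})$ for all $k\ge0$ are acyclic. (4) If $\mathbf P$ is contraction closed and closed under direct sum with $U_{1,1}$, then $(\mathcal M^{\mathbf P}_\bullet,\partial^{\mathrm{tot}}_{\mathrm{con}})$, $(\mathcal M^{\mathbf P}_\bullet,\partial_{\mathrm{con}})$, and $(\mathcal M^{\mathbf P}_{k,\bullet},\partial_{\mathrm{con}})$ for all $k\ge0$ are acyclic.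
   Context: Matroids have finite ground set $E(\mathsf M)$, rank $\mathrm{rk}$ and nullity $\mathrm{nul}(\mathsf M)=|E(\mathsf M)|-\mathrm{rk}(\mathsf M)$. $U_{r,n}$ is the uniform matroid of rank $r$ on $n$ elements ($U_{0,1}$ is a single loop, $U_{1,1}$ a single coloop). An orientation of $\mathsf M$ is a generator $\eta$ of $\bigwedge^{|E|}\mathbb{Z}\langle E\rangle$, $E=E(\mathsf M)$; $\varnothing$ has orientation $1$. $\mathcal M$ is the $\mathbb{Q}$-vector space spanned by symbols $[\mathsf M,\eta]$ modulo $[\mathsf M,-\eta]=-[\mathsf M,\eta]$ and $[\mathsf M,\eta]=[\mathsf M',\psi_*\eta]$ for every isomorphism $\psi:\mathsf M\to\mathsf M'$ ($\psi_*$ the induced map on top exterior powers). It is bigraded by $\mathcal M_{k,r}$ (nullity $k$, rank $r$) and graded by ground-set size $n=k+r$ ($\mathcal M_\bullet$). With $\iota_x$ interior product ($\iota_x(x\wedge\alpha)=\alpha$): $\partial_{\mathrm{del}}[\mathsf M,\eta]=\sum_{x\text{ not a coloop}}[\mathsf M\setminus x,\iota_x\eta]$ (bidegree $(-1,0)$), $\partial_{\mathrm{clp}}$ the same sum over coloops (bidegree $(0,-1)$), $\partial_{\mathrm{con}}[\mathsf M,\eta]=\sum_{x\text{ not a loop}}[\mathsf M/x,\iota_x\eta]$ (bidegree $(0,-1)$), $\partial_{\mathrm{lp}}$ the same sum over loops (bidegree $(-1,0)$); $\partial^{\mathrm{tot}}_{\mathrm{del}}=\partial_{\mathrm{del}}+\partial_{\mathrm{clp}}$,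 $\partial^{\mathrm{tot}}_{\mathrm{con}}=\partial_{\mathrm{lp}}+\partial_{\mathrm{con}}$. For a property $\mathbf P$ of matroids stable under isomorphism, $\mathcal M^{\mathbf P}$ is the span of classes $[\mathsf M,\eta]$ with $\mathsf M$ having $\mathbf P$, with induced gradings; $\mathcal M^{\mathbf P}_{\bullet,r}=\bigoplus_k\mathcal M^{\mathbf P}_{k,r}$ (fixed rank) and $\mathcal M^{\mathbf P}_{k,\bullet}=\bigoplus_r\mathcal M^{\mathbf P}_{k,r}$ (fixed nullity). $\mathbf P$ is deletion closed (resp. contraction closed) if $\mathsf M$ having $\mathbf P$ implies $\mathsf M\setminus x$ (resp. $\mathsf M/x$) has $\mathbf P$ for every $x\in E(\mathsf M)$; closed under direct sum with $U_{0,1}$ means $\mathsf M\oplus U_{0,1}$ has $\mathbf P$ whenever $\mathsf M$ does. -}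

module Defs where

open import Data.Nat using (ℕ; zero; suc; _∸_; _<ᵇ_)
open import Data.Bool using (Bool; true; false; not; _∧_; _∨_; if_then_else_)
open import Data.Fin using (Fin; toℕ)
open import Data.Fin.Subset using (Subset; ⁅_⁆; _∈_; _∉_; _⊆_; _∪_; ∣_∣)
  renaming (⊤ to Full; ⊥ to Empty)
open import Data.Fin.Permutation using (Permutation′; _⟨$⟩ʳ_)
open import Data.Vec using (Vec; []; _∷_; lookup; tabulate; insertAt)
open import Data.List using (List; []; _∷_; _++_; map; concatMap; foldr; allFin)
open import Data.List.Relation.Unary.All using (All)
open import Data.Product using (Σ; ∃; _×_; _,_; proj₁; proj₂)
open import Data.Rational using (ℚ; 0ℚ; 1ℚ; _+_; _*_; _-_; -_)
open import Relation.Binary.PropositionalEquality using (_≡_)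
open import Data.Nat using (_<_)

-- Raw matroid data on the ground set Fin n (ordered 0 < 1 < ... < n-1):
-- a Boolean independence predicate on subsets.

Raw : ℕ → Set
Raw n = Subset n → Bool

record IsMatroid {n : ℕ} (I : Raw n) : Set where
  field
    empty-indep : I Empty ≡ true
    hereditary  : ∀ A B → A ⊆ B → I B ≡ true → I A ≡ true
    augment     : ∀ A B → I A ≡ true → I B ≡ true → ∣ A ∣ < ∣ B ∣ →
                  ∃ λ x → x ∈ B × x ∉ A × I (A ∪ ⁅ x ⁆) ≡ true

allSubsets : (n : ℕ) → List (Subset n)
allSubsets zero    = [] ∷ []
allSubsets (suc n) = map (false ∷_) (allSubsets n) ++ map (true ∷_) (allSubsets n)

andL : List Bool → Bool
andL = foldr _∧_ true

subsetᵇ : {n : ℕ} → Subset n → Subset n → Bool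
subsetᵇ []      []      = true
subsetᵇ (a ∷ A) (b ∷ B) = (not a ∨ b) ∧ subsetᵇ A B

maxL : List ℕ → ℕ
maxL = foldr Data.Nat._⊔_ 0

rankOf : {n : ℕ} → Raw n → Subset n → ℕ
rankOf {n} M S =
  maxL (map (λ T → if M T ∧ subsetᵇ T S then ∣ T ∣ else 0) (allSubsets n))

rank : {n : ℕ} → Raw n → ℕ
rank M = rankOf M Full

nullity : {n : ℕ} → Raw n → ℕ
nullity {n} M = n ∸ rank M

eqRawᵇ : {n : ℕ} → Raw n → Raw n → Bool
eqRawᵇ {n} M N = andL (map (λ S → eqB (M S) (N S)) (allSubsets n))
  where
  eqB : Bool → Bool → Bool
  eqB true  b = b
  eqB false b = not b

-- Deletion, contraction, loops, coloops.  Removing element i of Fin (suc n)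
-- identifies the remaining ground set with Fin n order-preservingly.

delete : {n : ℕ} → Fin (suc n) → Raw (suc n) → Raw n
delete i M S = M (insertAt S i false)

contract : {n : ℕ} → Fin (suc n) → Raw (suc n) → Raw n
contract i M S =
  if M ⁅ i ⁆ then M (insertAt S i true) else M (insertAt S i false)

isLoop : {n : ℕ} → Fin n → Raw n → Bool
isLoop i M = not (M ⁅ i ⁆)

isColoop : {n : ℕ} → Fin (suc n) → Raw (suc n) → Bool
isColoop i M = rank (delete i M) <ᵇ rank M

-- direct sums with U_{0,1} and U_{1,1} (the new element placed first;
-- by isomorphism invariance the position is immaterial)
addLoop : {n : ℕ} → Raw n → Raw (suc n)
addLoop M (b ∷ S) = not b ∧ M S

addColoop : {n : ℕ} → Raw n → Raw (suc n)
addColoop M (b ∷ S) = M S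

-- image of M under ψ : T independent in ψ·M iff ψ⁻¹(T) independent in M
act : {n : ℕ} → Permutation′ n → Raw n → Raw n
act ψ M T = M (tabulate (λ i → lookup T (ψ ⟨$⟩ʳ i)))

signℚ : ℕ → ℚ
signℚ zero    = 1ℚ
signℚ (suc k) = - signℚ k

count : List Bool → ℕ
count = foldr (λ b k → if b then suc k else k) 0

inversions : {n : ℕ} → Permutation′ n → ℕ
inversions {n} ψ =
  count (concatMap (λ i → map (λ j → (toℕ i <ᵇ toℕ j) ∧ (toℕ (ψ ⟨$⟩ʳ j) <ᵇ toℕ (ψ ⟨$⟩ʳ i)))
                              (allFin n))
                   (allFin n))

-- sgn ψ, so that ψ_* (e₀ ∧ … ∧ e_{n-1}) = sgn ψ · (e₀ ∧ … ∧ e_{n-1})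
sgn : {n : ℕ} → Permutation′ n → ℚ
sgn ψ = signℚ (inversions ψ)

-- Every oriented matroid is isomorphic to one on Fin n;
-- the orientation ±(e₀ ∧ … ∧ e_{n-1}) is absorbed into the coefficient.
-- A chain of degree n (ground-set size n) is a formal ℚ-combination
-- of symbols [M, e₀ ∧ … ∧ e_{n-1}].

Chain : ℕ → Set
Chain n = List (ℚ × Raw n)

coeff : {n : ℕ} → Chain n → Raw n → ℚ
coeff c N = foldr (λ t q → if eqRawᵇ (proj₂ t) N then proj₁ t + q else q) 0ℚ c

-- generators of the relation subspace:  [M] - sgn ψ · [ψ·M]
RelTerm : ℕ → Set
RelTerm n = ℚ × Σ (Raw n) IsMatroid × Permutation′ n

relChain : {n : ℕ} → List (RelTerm n) → Chain n
relChain = concatMap (λ { (λ' , (M , _) , ψ) → (λ' , M) ∷ (- (λ' * sgn ψ) , act ψ M) ∷ [] })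

-- equality in 𝓜 : the difference lies in the span of the relations
infix 4 _≈_
_≈_ : {n : ℕ} → Chain n → Chain n → Set
_≈_ {n} c c' = ∃ λ (R : List (RelTerm n)) →
  ∀ (N : Raw n) → coeff c N - coeff c' N ≡ coeff (relChain R) N

-- Differentials (ι_{e_i}(e₀∧…∧e_n) = (-1)^i e₀∧…ê_i…∧e_n)

Differential : Set
Differential = ∀ {n} → Chain (suc n) → Chain n

∂gen : (∀ {n} → Fin (suc n) → Raw (suc n) → Bool) →
       (∀ {n} → Fin (suc n) → Raw (suc n) → Raw n) → Differential
∂gen sel op {n} c =
  concatMap (λ t → concatMap (λ i → if sel i (proj₂ t)
                                      then (proj₁ t * signℚ (toℕ i) , op i (proj₂ t)) ∷ []
                                      else [])
                             (allFin (suc n)))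
            c

∂del ∂clp ∂con ∂lp ∂deltot ∂contot : Differential
∂del = ∂gen (λ i M → not (isColoop i M)) delete
∂clp = ∂gen isColoop delete
∂con = ∂gen (λ i M → not (isLoop i M)) contract
∂lp  = ∂gen isLoop contract
∂deltot c = ∂del c ++ ∂clp c
∂contot c = ∂lp c ++ ∂con c

MatroidProperty : Set₁
MatroidProperty = ∀ {n} → Raw n → Set

IsoStable DeletionClosed ContractionClosed
  LoopSumClosed ColoopSumClosed : MatroidProperty → Set
IsoStable P = ∀ {n} (M : Raw n) (ψ : Permutation′ n) →
  IsMatroid M → P M → P (act ψ M)
DeletionClosed P = ∀ {n} (M : Raw (suc n)) (i : Fin (suc n)) →
  IsMatroid M → P M → P (delete i M)
ContractionClosed P = ∀ {n} (M : Raw (suc n)) (i : Fin (suc n)) →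
  IsMatroid M → P M → P (contract i M)
LoopSumClosed P = ∀ {n} (M : Raw n) → IsMatroid M → P M → P (addLoop M)
ColoopSumClosed P = ∀ {n} (M : Raw n) → IsMatroid M → P M → P (addColoop M)

-- spanning sets of 𝓜^P_•, 𝓜^P_{•,r}, 𝓜^P_{k,•}
MP : MatroidProperty → MatroidProperty
MP P M = IsMatroid M × P M

MPrank : MatroidProperty → ℕ → MatroidProperty
MPrank P r M = MP P M × rank M ≡ r

MPnul : MatroidProperty → ℕ → MatroidProperty
MPnul P k M = MP P M × nullity M ≡ k

Supported : {n : ℕ} → MatroidProperty → Chain n → Set
Supported Q c = All (λ t → Q (proj₂ t)) c

-- the subcomplex of (𝓜_•, ∂) spanned by Q-matroids has zero homology
-- in every degree n ≥ 0 (in degree 0 every chain must be a boundary)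
Acyclic : MatroidProperty → Differential → Set
Acyclic Q ∂ =
  (∀ (c : Chain 0) → Supported Q c →
     ∃ λ (d : Chain 1) → Supported Q d × ∂ d ≈ c) ×
  (∀ (n : ℕ) (c : Chain (suc n)) → Supported Q c → ∂ c ≈ [] →
     ∃ λ (d : Chain (suc (suc n))) → Supported Q d × ∂ d ≈ c)

module Submission where

-- Adjoining a loop (or a coloop) as a new first element, h M = M ⊕ U₀₁ (or M ⊕ U₁₁),
-- commutes with deleting or contracting any old element and with relabelling, and
-- deleting the new element gives M back.  Since the old elements move one place to
-- the right, their faces in ∂(h M) are exactly −h(∂ M), so ∂h + h∂ = s·id, where s
-- is 1 if ∂ removes the new element and 0 otherwise; for the totals, s = 0 + 1.
-- When s = 1, h is a contracting homotopy on any family of matroids closed under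
-- adjoining the element, and such a family spans an acyclic complex.

open import Algebra.Bundles using (CommutativeMonoid)
open import Data.Bool using (Bool; true; false; not; _∧_; if_then_else_; T)
open import Data.Bool.Properties using (T-≡; ⇔→≡; ∧-zeroʳ; ¬-not)
open import Data.Empty using (⊥-elim)
open import Data.Fin using (Fin; zero; suc; toℕ)
open import Data.Fin.Permutation using (Permutation′; _⟨$⟩ʳ_; lift₀)
open import Data.Fin.Subset using (Subset; _⊆_; _∪_; ⁅_⁆; _∉_; ∣_∣)
  renaming (_∈_ to _∈ₛ_; ⊤ to Full; ⊥ to Empty)
open import Data.Fin.Subset.Properties using (drop-∷-⊆; drop-there; ∪-identityʳ)
open import Data.List using (List; []; _∷_; _++_; map; concat; concatMap; tabulate; allFin)
open import Data.List.Membership.Propositional using (_∈_; lose)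
open import Data.List.Membership.Propositional.Properties using (∈-++⁺ˡ; ∈-++⁺ʳ; ∈-map⁺)
open import Data.List.Properties
  using (map-++; map-∘; map-cong; map-tabulate; map-concatMap; ++-assoc; ++-identityʳ)
open import Data.List.Relation.Unary.All as All using (All; []; _∷_)
open import Data.List.Relation.Unary.All.Properties using (all⁺; all⁻; ¬All⇒Any¬; map⁺)
open import Data.List.Relation.Unary.Any using (Any; here; there; satisfied)
open import Data.Nat as ℕ using (ℕ; zero; suc; _⊔_; _<ᵇ_; _∸_; _<_; s≤s)
open import Data.Nat.Properties
  using (⊔-assoc; ⊔-identityʳ; m≤n⇒m⊔n≡n; n≤1+n; n<1+n; <-trans; n≮n; <⇒<ᵇ; <ᵇ⇒<)
open import Data.Product using (∃; _×_; _,_; proj₁; map₁; map₂)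
open import Data.Rational using (ℚ; 0ℚ; _+_; _*_; _-_; -_)
open import Data.Rational.Properties
  using ( +-identityˡ; +-identityʳ; +-assoc; +-inverseˡ; +-inverseʳ; *-identityʳ
        ; neg-distrib-+; neg-distribˡ-*; neg-distribʳ-*; +-0-commutativeMonoid)
open import Data.Rational.Solver using (module +-*-Solver)
open import Data.Sum using (_⊎_; inj₁; inj₂)
open import Data.Vec using ([]; _∷_; here; there; insertAt)
open import Function using (_∘_; _⇔_; mk⇔; Equivalence)
import Function.Properties.Equivalence as ⇔
open import Relation.Binary.Bundles using (Setoid)
open import Relation.Binary.PropositionalEquality
import Relation.Binary.Reasoning.Setoid as SetoidReasoning
open import Relation.Binary.Structures using (IsEquivalence)
open import Relation.Nullary using (Dec; yes; no; ¬_)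
open import Relation.Nullary.Decidable using (map′; T?)

open import Algebra.Properties.CommutativeSemigroup
  (CommutativeMonoid.commutativeSemigroup +-0-commutativeMonoid) using (interchange)
open +-*-Solver using (solve; _:+_; :-_; _:-_; _:=_)

open import Defs

∈-allSubsets : ∀ {n} (S : Subset n) → S ∈ allSubsets n
∈-allSubsets []                  = here refl
∈-allSubsets {suc n} (false ∷ S) = ∈-++⁺ˡ (∈-map⁺ (false ∷_) (∈-allSubsets S))
∈-allSubsets {suc n} (true ∷ S)  =
  ∈-++⁺ʳ (map (false ∷_) (allSubsets n)) (∈-map⁺ (true ∷_) (∈-allSubsets S))

module _ {n : ℕ} (M N : Raw n) where

  eqRawᵇ-sound : T (eqRawᵇ M N) → M ≗ N
  eqRawᵇ-sound M≡N S with M S | N S | All.lookup (all⁺ _ (allSubsets n) M≡N) (∈-allSubsets S)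
  ... | true  | true  | _ = refl
  ... | false | false | _ = refl

  eqRawᵇ-complete : M ≗ N → T (eqRawᵇ M N)
  eqRawᵇ-complete M≗N with T? (eqRawᵇ M N)
  ... | yes M≡N = M≡N
  ... | no M≢N with satisfied (¬All⇒Any¬ (T? ∘ _) (allSubsets n) (M≢N ∘ all⁻ _))
  ...   | S , disagree with M S | N S | M≗N S
  ...     | true  | .true  | refl = ⊥-elim (disagree _)
  ...     | false | .false | refl = ⊥-elim (disagree _)

T-eqRawᵇ : ∀ {n} {M N : Raw n} → T (eqRawᵇ M N) ⇔ M ≗ N
T-eqRawᵇ {M = M} {N} = mk⇔ (eqRawᵇ-sound M N) (eqRawᵇ-complete M N)

eqRawᵇ-resp : ∀ {n m} {M N : Raw n} {M′ N′ : Raw m} →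
              M ≗ N ⇔ M′ ≗ N′ → eqRawᵇ M N ≡ eqRawᵇ M′ N′
eqRawᵇ-resp M≗N⇔M′≗N′ =
  ⇔→≡ (⇔.trans (⇔.sym T-≡) (⇔.trans T-eqRawᵇ (⇔.trans M≗N⇔M′≗N′ (⇔.trans (⇔.sym T-eqRawᵇ) T-≡))))

infix 4 _≗?_
_≗?_ : ∀ {n} (M N : Raw n) → Dec (M ≗ N)
M ≗? N = map′ (eqRawᵇ-sound M N) (eqRawᵇ-complete M N) (T? (eqRawᵇ M N))

-- A record rather than a synonym for  coeff c ≗ coeff c′,  so that c and c′ can be inferred.
infix 4 _≐_
record _≐_ {n : ℕ} (c c′ : Chain n) : Set where
  constructor coeffwise
  field coeff-≗ : coeff c ≗ coeff c′
open _≐_ public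

≐-refl : ∀ {n} {c : Chain n} → c ≐ c
≐-refl = coeffwise λ _ → refl

≐-reflexive : ∀ {n} {c c′ : Chain n} → c ≡ c′ → c ≐ c′
≐-reflexive refl = ≐-refl

≐-isEquivalence : ∀ {n} → IsEquivalence (_≐_ {n})
≐-isEquivalence = record
  { refl  = ≐-refl
  ; sym   = λ c≐c′ → coeffwise λ N → sym (coeff-≗ c≐c′ N)
  ; trans = λ c≐c′ c′≐c″ → coeffwise λ N → trans (coeff-≗ c≐c′ N) (coeff-≗ c′≐c″ N)
  }

≐-setoid : ℕ → Setoid _ _
≐-setoid n = record { isEquivalence = ≐-isEquivalence {n} }

coeff-++ : ∀ {n} (c c′ : Chain n) N → coeff (c ++ c′) N ≡ coeff c N + coeff c′ N
coeff-++ []            c′ N = sym (+-identityˡ _)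
coeff-++ ((q , M) ∷ c) c′ N with eqRawᵇ M N
... | true  = trans (cong (q +_) (coeff-++ c c′ N)) (sym (+-assoc q _ _))
... | false = coeff-++ c c′ N

∷-cong : ∀ {n} {q q′ : ℚ} {M M′ : Raw n} {c c′} →
         q ≡ q′ → M ≗ M′ → c ≐ c′ → (q , M) ∷ c ≐ (q′ , M′) ∷ c′
∷-cong {q = q} refl M≗M′ c≐c′ = coeffwise λ N →
  cong₂ (λ b x → if b then q + x else x)
        (eqRawᵇ-resp (mk⇔ (λ M≗N S → trans (sym (M≗M′ S)) (M≗N S))
                          (λ M′≗N S → trans (M≗M′ S) (M′≗N S))))
        (coeff-≗ c≐c′ N)

++-cong : ∀ {n} {c₁ c₁′ c₂ c₂′ : Chain n} → c₁ ≐ c₁′ → c₂ ≐ c₂′ → c₁ ++ c₂ ≐ c₁′ ++ c₂′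
++-cong {c₁ = c₁} {c₁′} {c₂} {c₂′} c₁≐c₁′ c₂≐c₂′ = coeffwise λ N → begin
  coeff (c₁ ++ c₂) N          ≡⟨ coeff-++ c₁ c₂ N ⟩
  coeff c₁ N + coeff c₂ N     ≡⟨ cong₂ _+_ (coeff-≗ c₁≐c₁′ N) (coeff-≗ c₂≐c₂′ N) ⟩
  coeff c₁′ N + coeff c₂′ N   ≡⟨ coeff-++ c₁′ c₂′ N ⟨
  coeff (c₁′ ++ c₂′) N        ∎
  where open ≡-Reasoning

concatMap-cong : ∀ {A : Set} {n} {f g : A → Chain n} → (∀ x → f x ≐ g x) → ∀ xs →
                 concatMap f xs ≐ concatMap g xs
concatMap-cong f≐g []       = ≐-refl
concatMap-cong f≐g (x ∷ xs) = ++-cong (f≐g x) (concatMap-cong f≐g xs)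

++-interchange : ∀ {n} (a b c d : Chain n) → (a ++ b) ++ (c ++ d) ≐ (a ++ c) ++ (b ++ d)
++-interchange a b c d = coeffwise λ N → begin
  coeff ((a ++ b) ++ (c ++ d)) N
    ≡⟨ expand a b c d N ⟩
  (coeff a N + coeff b N) + (coeff c N + coeff d N)
    ≡⟨ interchange (coeff a N) (coeff b N) (coeff c N) (coeff d N) ⟩
  (coeff a N + coeff c N) + (coeff b N + coeff d N)
    ≡⟨ expand a c b d N ⟨
  coeff ((a ++ c) ++ (b ++ d)) N
    ∎
  where
  open ≡-Reasoning
  expand : ∀ w x y z N → coeff ((w ++ x) ++ (y ++ z)) N ≡ (coeff w N + coeff x N) + (coeff y N + coeff z N)
  expand w x y z N = trans (coeff-++ (w ++ x) (y ++ z) N) (cong₂ _+_ (coeff-++ w x N) (coeff-++ y z N))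

negate : ∀ {n} → Chain n → Chain n
negate = map (map₁ (-_))

coeff-negate : ∀ {n} (c : Chain n) N → coeff (negate c) N ≡ - coeff c N
coeff-negate []            N = refl
coeff-negate ((q , M) ∷ c) N with eqRawᵇ M N
... | true  = trans (cong (- q +_) (coeff-negate c N)) (sym (neg-distrib-+ q _))
... | false = coeff-negate c N

negate-++-cancel : ∀ {n} (c : Chain n) → negate c ++ c ≐ []
negate-++-cancel c = coeffwise λ N → begin
  coeff (negate c ++ c) N            ≡⟨ coeff-++ (negate c) c N ⟩
  coeff (negate c) N + coeff c N     ≡⟨ cong (_+ coeff c N) (coeff-negate c N) ⟩
  - coeff c N + coeff c N            ≡⟨ +-inverseˡ (coeff c N) ⟩
  0ℚ                                 ∎
  where open ≡-Reasoning

select : ∀ {A : Set} → Bool → List A → List A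
select b xs = if b then xs else []

select-[] : ∀ {A : Set} b → select {A} b [] ≡ []
select-[] true  = refl
select-[] false = refl

select-++ : ∀ {A : Set} b (xs ys : List A) → select b (xs ++ ys) ≡ select b xs ++ select b ys
select-++ true  xs ys = refl
select-++ false xs ys = refl

select-complement : ∀ {A : Set} b (xs : List A) → select b xs ++ select (not b) xs ≡ xs
select-complement true  xs = ++-identityʳ xs
select-complement false xs = refl

map-select : ∀ {A B : Set} (f : A → B) b xs → map f (select b xs) ≡ select b (map f xs)
map-select f true  xs = refl
map-select f false xs = refl

select-cong : ∀ {n} b {c c′ : Chain n} → c ≐ c′ → select b c ≐ select b c′
select-cong true  c≐c′ = c≐c′
select-cong false _    = ≐-refl

maxL-++ : ∀ xs ys → maxL (xs ++ ys) ≡ maxL xs ⊔ maxL ys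
maxL-++ []       ys = refl
maxL-++ (x ∷ xs) ys = trans (cong (x ⊔_) (maxL-++ xs ys)) (sym (⊔-assoc x _ _))

maxL-zeros : ∀ {A : Set} (xs : List A) → maxL (map (λ _ → 0) xs) ≡ 0
maxL-zeros []       = refl
maxL-zeros (_ ∷ xs) = maxL-zeros xs

module _ {A : Set} (b : A → Bool) (k : A → ℕ) where
  private
    max⁰ max⁺ : List A → ℕ
    max⁰ xs = maxL (map (λ x → if b x then k x else 0) xs)
    max⁺ xs = maxL (map (λ x → if b x then suc (k x) else 0) xs)

    max⁺-suc-or-zero : ∀ xs → max⁺ xs ≡ suc (max⁰ xs) ⊎ (max⁺ xs ≡ 0 × max⁰ xs ≡ 0)
    max⁺-∷-selected  : ∀ x xs → suc (k x) ⊔ max⁺ xs ≡ suc (k x ⊔ max⁰ xs)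

    max⁺-suc-or-zero []       = inj₂ (refl , refl)
    max⁺-suc-or-zero (x ∷ xs) with b x
    ... | true  = inj₁ (max⁺-∷-selected x xs)
    ... | false = max⁺-suc-or-zero xs

    max⁺-∷-selected x xs with max⁺-suc-or-zero xs
    ... | inj₁ max⁺≡suc          = cong (suc (k x) ⊔_) max⁺≡suc
    ... | inj₂ (max⁺≡0 , max⁰≡0) = begin
      suc (k x) ⊔ max⁺ xs   ≡⟨ cong (suc (k x) ⊔_) max⁺≡0 ⟩
      suc (k x)             ≡⟨ cong suc (⊔-identityʳ (k x)) ⟨
      suc (k x ⊔ 0)         ≡⟨ cong (λ m → suc (k x ⊔ m)) max⁰≡0 ⟨
      suc (k x ⊔ max⁰ xs)   ∎
      where open ≡-Reasoning

  maxL-map-suc : ∀ {xs} → Any (T ∘ b) xs →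
    maxL (map (λ x → if b x then suc (k x) else 0) xs) ≡ suc (maxL (map (λ x → if b x then k x else 0) xs))
  maxL-map-suc {x ∷ xs} (here bx) with b x
  ... | true  = max⁺-∷-selected x xs
  maxL-map-suc {x ∷ xs} (there b∈xs) with b x
  ... | true  = cong (suc (k x) ⊔_) (maxL-map-suc b∈xs)
  ... | false = maxL-map-suc b∈xs

subsetᵇ-Full : ∀ {n} (T : Subset n) → subsetᵇ T Full ≡ true
subsetᵇ-Full []          = refl
subsetᵇ-Full (false ∷ T) = subsetᵇ-Full T
subsetᵇ-Full (true ∷ T)  = subsetᵇ-Full T

rank-cong : ∀ {n} {M M′ : Raw n} → M ≗ M′ → rank M ≡ rank M′
rank-cong {n} M≗M′ =
  cong maxL (map-cong (λ T → cong (λ b → if b ∧ subsetᵇ T Full then ∣ T ∣ else 0) (M≗M′ T)) (allSubsets n))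

rank-∷ : ∀ {n} (M : Raw (suc n)) → rank M ≡
  rank (delete zero M) ⊔ maxL (map (λ T → if M (true ∷ T) ∧ subsetᵇ T Full then suc ∣ T ∣ else 0) (allSubsets n))
rank-∷ {n} M = begin
  maxL (map size (map (false ∷_) xs ++ map (true ∷_) xs))
    ≡⟨ cong maxL (map-++ size (map (false ∷_) xs) _) ⟩
  maxL (map size (map (false ∷_) xs) ++ map size (map (true ∷_) xs))
    ≡⟨ maxL-++ (map size (map (false ∷_) xs)) _ ⟩
  maxL (map size (map (false ∷_) xs)) ⊔ maxL (map size (map (true ∷_) xs))
    ≡⟨ cong₂ (λ l r → maxL l ⊔ maxL r) (map-∘ xs) (map-∘ xs) ⟨
  maxL (map (size ∘ (false ∷_)) xs) ⊔ maxL (map (size ∘ (true ∷_)) xs)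
    ∎
  where
  open ≡-Reasoning
  xs : List (Subset n)
  xs = allSubsets n
  size : Subset (suc n) → ℕ
  size T = if M T ∧ subsetᵇ T Full then ∣ T ∣ else 0

rank-addLoop : ∀ {n} (M : Raw n) → rank (addLoop M) ≡ rank M
rank-addLoop {n} M = begin
  rank (addLoop M)                              ≡⟨ rank-∷ (addLoop M) ⟩
  rank M ⊔ maxL (map (λ _ → 0) (allSubsets n))  ≡⟨ cong (rank M ⊔_) (maxL-zeros (allSubsets n)) ⟩
  rank M ⊔ 0                                    ≡⟨ ⊔-identityʳ (rank M) ⟩
  rank M                                        ∎
  where open ≡-Reasoning

rank-addColoop : ∀ {n} (M : Raw n) → M Empty ≡ true → rank (addColoop M) ≡ suc (rank M)
rank-addColoop {n} M ∅-independent = begin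
  rank (addColoop M)
    ≡⟨ rank-∷ (addColoop M) ⟩
  rank M ⊔ maxL (map (λ T → if independent T then suc ∣ T ∣ else 0) (allSubsets n))
    ≡⟨ cong (rank M ⊔_) (maxL-map-suc independent ∣_∣ (lose (∈-allSubsets Empty) Empty-independent)) ⟩
  rank M ⊔ suc (rank M)
    ≡⟨ m≤n⇒m⊔n≡n (n≤1+n (rank M)) ⟩
  suc (rank M)
    ∎
  where
  open ≡-Reasoning
  independent : Subset n → Bool
  independent T = M T ∧ subsetᵇ T Full
  Empty-independent : T (independent Empty)
  Empty-independent rewrite ∅-independent | subsetᵇ-Full {n} Empty = _

insertAt-Empty : ∀ {n} (i : Fin (suc n)) → insertAt (Empty {n}) i false ≡ Empty
insertAt-Empty zero            = refl
insertAt-Empty {suc n} (suc i) = cong (false ∷_) (insertAt-Empty i)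

-- The cases where B contains the loop are absurd, since then addLoop M B ≡ false.
addLoop-isMatroid : ∀ {n} {M : Raw n} → IsMatroid M → IsMatroid (addLoop M)
addLoop-isMatroid {M = M} m = record
  { empty-indep = empty-indep
  ; hereditary  = hereditary′
  ; augment     = augment′
  }
  where
  open IsMatroid m
  hereditary′ : ∀ A B → A ⊆ B → addLoop M B ≡ true → addLoop M A ≡ true
  hereditary′ (true ∷ A)  (false ∷ B) A⊆B _ with A⊆B here
  ... | ()
  hereditary′ (false ∷ A) (false ∷ B) A⊆B = hereditary A B (drop-∷-⊆ A⊆B)
  augment′ : ∀ A B → addLoop M A ≡ true → addLoop M B ≡ true → ∣ A ∣ < ∣ B ∣ →
             ∃ λ x → x ∈ₛ B × x ∉ A × addLoop M (A ∪ ⁅ x ⁆) ≡ true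
  augment′ (false ∷ A) (false ∷ B) A-indep B-indep |A|<|B|
    with x , x∈B , x∉A , A+x-indep ← augment A B A-indep B-indep |A|<|B|
    = suc x , there x∈B , x∉A ∘ drop-there , A+x-indep

addColoop-isMatroid : ∀ {n} {M : Raw n} → IsMatroid M → IsMatroid (addColoop M)
addColoop-isMatroid {M = M} m = record
  { empty-indep = empty-indep
  ; hereditary  = λ { (_ ∷ A) (_ ∷ B) A⊆B → hereditary A B (drop-∷-⊆ A⊆B) }
  ; augment     = augment′
  }
  where
  open IsMatroid m
  extend : ∀ {a b A B} → ∃ (λ x → x ∈ₛ B × x ∉ A × M (A ∪ ⁅ x ⁆) ≡ true) →
           ∃ λ x → x ∈ₛ b ∷ B × x ∉ a ∷ A × addColoop M ((a ∷ A) ∪ ⁅ x ⁆) ≡ true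
  extend (x , x∈B , x∉A , A+x-indep) = suc x , there x∈B , x∉A ∘ drop-there , A+x-indep
  augment′ : ∀ A B → addColoop M A ≡ true → addColoop M B ≡ true → ∣ A ∣ < ∣ B ∣ →
             ∃ λ x → x ∈ₛ B × x ∉ A × addColoop M (A ∪ ⁅ x ⁆) ≡ true
  augment′ (false ∷ A) (true ∷ B)  A-indep _ _ =
    zero , here , (λ ()) , trans (cong M (∪-identityʳ A)) A-indep
  augment′ (false ∷ A) (false ∷ B) A-indep B-indep |A|<|B|       =
    extend (augment A B A-indep B-indep |A|<|B|)
  augment′ (true ∷ A)  (true ∷ B)  A-indep B-indep (s≤s |A|<|B|) =
    extend (augment A B A-indep B-indep |A|<|B|)
  augment′ (true ∷ A)  (false ∷ B) A-indep B-indep 1+|A|<|B|     =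
    extend (augment A B A-indep B-indep (<-trans (n<1+n _) 1+|A|<|B|))

map-tabulate-suc : ∀ {A : Set} {n} (f : Fin (suc n) → A) → map f (tabulate suc) ≡ map (f ∘ suc) (allFin n)
map-tabulate-suc f = trans (map-tabulate suc f) (sym (map-tabulate (λ i → i) (f ∘ suc)))

count-++ : ∀ xs ys → count (xs ++ ys) ≡ count xs ℕ.+ count ys
count-++ []           ys = refl
count-++ (true ∷ xs)  ys = cong suc (count-++ xs ys)
count-++ (false ∷ xs) ys = count-++ xs ys

count-map-false : ∀ {A : Set} {f : A → Bool} → (∀ x → f x ≡ false) → ∀ xs → count (map f xs) ≡ 0
count-map-false f≡false []       = refl
count-map-false f≡false (x ∷ xs) rewrite f≡false x = count-map-false f≡false xs

count-concatMap-cong : ∀ {A : Set} {f g : A → List Bool} → (∀ x → count (f x) ≡ count (g x)) →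
                       ∀ xs → count (concatMap f xs) ≡ count (concatMap g xs)
count-concatMap-cong f~g []                   = refl
count-concatMap-cong {f = f} {g} f~g (x ∷ xs) = begin
  count (f x ++ concatMap f xs)            ≡⟨ count-++ (f x) _ ⟩
  count (f x) ℕ.+ count (concatMap f xs)   ≡⟨ cong₂ ℕ._+_ (f~g x) (count-concatMap-cong f~g xs) ⟩
  count (g x) ℕ.+ count (concatMap g xs)   ≡⟨ count-++ (g x) _ ⟨
  count (g x ++ concatMap g xs)            ∎
  where open ≡-Reasoning

inversions-lift₀ : ∀ {n} (ψ : Permutation′ n) → inversions (lift₀ ψ) ≡ inversions ψ
inversions-lift₀ {n} ψ = begin
  count (row zero ++ concatMap row (tabulate suc))
    ≡⟨ count-++ (row zero) _ ⟩
  count (row zero) ℕ.+ count (concatMap row (tabulate suc))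
    ≡⟨ cong₂ ℕ._+_ (count-map-false {f = inverted zero} (λ j → ∧-zeroʳ _) (allFin (suc n)))
                   (cong (count ∘ concat) (map-tabulate-suc row)) ⟩
  count (concatMap (row ∘ suc) (allFin n))
    ≡⟨ count-concatMap-cong (λ i → cong count (map-tabulate-suc (inverted (suc i)))) (allFin n) ⟩
  inversions ψ
    ∎
  where
  open ≡-Reasoning
  inverted : Fin (suc n) → Fin (suc n) → Bool
  inverted i j = (toℕ i <ᵇ toℕ j) ∧ (toℕ (lift₀ ψ ⟨$⟩ʳ j) <ᵇ toℕ (lift₀ ψ ⟨$⟩ʳ i))
  row : Fin (suc n) → List Bool
  row i = map (inverted i) (allFin (suc n))

sgn-lift₀ : ∀ {n} (ψ : Permutation′ n) → sgn (lift₀ ψ) ≡ sgn ψ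
sgn-lift₀ ψ = cong signℚ (inversions-lift₀ ψ)

Selector : Set
Selector = ∀ {n} → Fin (suc n) → Raw (suc n) → Bool

Removal : Set
Removal = ∀ {n} → Fin (suc n) → Raw (suc n) → Raw n

face : Selector → Removal → ∀ {n} → ℚ → Raw (suc n) → Fin (suc n) → Chain n
face sel op q M i = select (sel i M) ((q * signℚ (toℕ i) , op i M) ∷ [])

-- ∂gen sel op is definitionally  concatMap (faces sel op).
faces : Selector → Removal → ∀ {n} → ℚ × Raw (suc n) → Chain n
faces sel op {n} (q , M) = concatMap (face sel op q M) (allFin (suc n))

record Adjoin : Set where
  field
    adjoin             : ∀ {n} → Raw n → Raw (suc n)
    adjoin-cong        : ∀ {n} {M M′ : Raw n} → M ≗ M′ → adjoin M ≗ adjoin M′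
    delete-zero-adjoin : ∀ {n} (M : Raw n) → delete zero (adjoin M) ≗ M
    adjoin-isMatroid   : ∀ {n} {M : Raw n} → IsMatroid M → IsMatroid (adjoin M)
    act-lift₀-adjoin   : ∀ {n} (ψ : Permutation′ n) (M : Raw n) → act (lift₀ ψ) (adjoin M) ≗ adjoin (act ψ M)

module Homotopy (A : Adjoin) where
  open Adjoin A

  adjoinChain : ∀ {n} → Chain n → Chain (suc n)
  adjoinChain = map (map₂ adjoin)

  Adjoined : ∀ {n} → Raw (suc n) → Set
  Adjoined N = adjoin (delete zero N) ≗ N

  adjoin≗⇔≗delete-zero : ∀ {n} {M : Raw n} {N} → Adjoined N → adjoin M ≗ N ⇔ M ≗ delete zero N
  adjoin≗⇔≗delete-zero {M = M} adjoined = mk⇔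
    (λ M⁺≗N S → trans (sym (delete-zero-adjoin M S)) (M⁺≗N (false ∷ S)))
    (λ M≗N⁻ S → trans (adjoin-cong M≗N⁻ S) (adjoined S))

  adjoin≗⇒Adjoined : ∀ {n} {M : Raw n} {N} → adjoin M ≗ N → Adjoined N
  adjoin≗⇒Adjoined {M = M} M⁺≗N S =
    trans (adjoin-cong (λ S′ → trans (sym (M⁺≗N (false ∷ S′))) (delete-zero-adjoin M S′)) S) (M⁺≗N S)

  coeff-adjoinChain : ∀ {n} (c : Chain n) {N} → Adjoined N → coeff (adjoinChain c) N ≡ coeff c (delete zero N)
  coeff-adjoinChain []            adjoined = refl
  coeff-adjoinChain ((q , M) ∷ c) adjoined =
    cong₂ (λ b x → if b then q + x else x)
          (eqRawᵇ-resp (adjoin≗⇔≗delete-zero adjoined)) (coeff-adjoinChain c adjoined)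

  coeff-adjoinChain-¬Adjoined : ∀ {n} (c : Chain n) {N} → ¬ Adjoined N → coeff (adjoinChain c) N ≡ 0ℚ
  coeff-adjoinChain-¬Adjoined []                ¬adjoined = refl
  coeff-adjoinChain-¬Adjoined ((q , M) ∷ c) {N} ¬adjoined
    rewrite ¬-not {eqRawᵇ (adjoin M) N} {true}
                  (¬adjoined ∘ adjoin≗⇒Adjoined ∘ Equivalence.to T-eqRawᵇ ∘ Equivalence.from T-≡)
    = coeff-adjoinChain-¬Adjoined c ¬adjoined

  adjoinChain-cong : ∀ {n} {c c′ : Chain n} → c ≐ c′ → adjoinChain c ≐ adjoinChain c′
  adjoinChain-cong {c = c} {c′} c≐c′ = coeffwise coeff-adjoinChain-≡
    where
    coeff-adjoinChain-≡ : ∀ N → coeff (adjoinChain c) N ≡ coeff (adjoinChain c′) N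
    coeff-adjoinChain-≡ N with adjoin (delete zero N) ≗? N
    ... | yes adjoined = trans (coeff-adjoinChain c adjoined)
                               (trans (coeff-≗ c≐c′ (delete zero N)) (sym (coeff-adjoinChain c′ adjoined)))
    ... | no ¬adjoined = trans (coeff-adjoinChain-¬Adjoined c ¬adjoined)
                               (sym (coeff-adjoinChain-¬Adjoined c′ ¬adjoined))

  liftRelations : ∀ {n} → List (RelTerm n) → List (RelTerm (suc n))
  liftRelations = map λ (l , (M , m) , ψ) → (- l , (adjoin M , adjoin-isMatroid m) , lift₀ ψ)

  relChain-liftRelations : ∀ {n} (R : List (RelTerm n)) →
                           relChain (liftRelations R) ≐ negate (adjoinChain (relChain R))
  relChain-liftRelations []                      = ≐-refl
  relChain-liftRelations ((l , (M , _) , ψ) ∷ R) =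
    ∷-cong refl (λ _ → refl) (∷-cong sign-lifted (act-lift₀-adjoin ψ M) (relChain-liftRelations R))
    where
    sign-lifted : - (- l * sgn (lift₀ ψ)) ≡ - - (l * sgn ψ)
    sign-lifted = cong -_ (trans (cong (- l *_) (sgn-lift₀ ψ)) (sym (neg-distribˡ-* l (sgn ψ))))

  record Compatible (sel : Selector) (op : Removal) (s : Bool) : Set where
    field
      selects-new : ∀ {n} (M : Raw n) → IsMatroid M → sel zero (adjoin M) ≡ s
      removes-new : ∀ {n} (M : Raw n) → op zero (adjoin M) ≗ M
      selects-old : ∀ {n} (M : Raw (suc n)) i → IsMatroid M → sel (suc i) (adjoin M) ≡ sel i M
      removes-old : ∀ {n} (M : Raw (suc n)) i → op (suc i) (adjoin M) ≗ adjoin (op i M)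

  complement : ∀ {sel : Selector} {op : Removal} {s} →
               Compatible sel op s → Compatible (λ i M → not (sel i M)) op (not s)
  complement compatible = record
    { selects-new = λ M m → cong not (selects-new M m)
    ; removes-new = removes-new
    ; selects-old = λ M i m → cong not (selects-old M i m)
    ; removes-old = removes-old
    }
    where open Compatible compatible

  record HomotopyIdentity (s : Bool) (∂ : Differential) : Set where
    field
      degree-zero : ∀ (c : Chain 0) → Supported IsMatroid c → ∂ (adjoinChain c) ≐ select s c
      degree-suc  : ∀ {n} (c : Chain (suc n)) → Supported IsMatroid c →
                    ∂ (adjoinChain c) ++ adjoinChain (∂ c) ≐ select s c

  module _ {sel : Selector} {op : Removal} {s : Bool} (compatible : Compatible sel op s) where
    open Compatible compatible

    new-face : ∀ {n} q (M : Raw n) → IsMatroid M → face sel op q (adjoin M) zero ≐ select s ((q , M) ∷ [])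
    new-face q M m rewrite selects-new M m = select-cong s (∷-cong (*-identityʳ q) (removes-new M) ≐-refl)

    -- Every old element moves one place to the right, which flips the sign of its face.
    old-face : ∀ {n} q (M : Raw (suc n)) → IsMatroid M → ∀ i →
               face sel op q (adjoin M) (suc i) ≐ negate (adjoinChain (face sel op q M i))
    old-face {n} q M m i = begin
      face sel op q (adjoin M) (suc i)
        ≡⟨ cong (λ b → select b ((q * - signℚ (toℕ i) , op (suc i) (adjoin M)) ∷ [])) (selects-old M i m) ⟩
      select (sel i M) ((q * - signℚ (toℕ i) , op (suc i) (adjoin M)) ∷ [])
        ≈⟨ select-cong (sel i M) (∷-cong (sym (neg-distribʳ-* q _)) (removes-old M i) ≐-refl) ⟩
      select (sel i M) ((- (q * signℚ (toℕ i)) , adjoin (op i M)) ∷ [])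
        ≡⟨ trans (cong negate (map-select (map₂ adjoin) (sel i M) _)) (map-select (map₁ (-_)) (sel i M) _) ⟨
      negate (adjoinChain (face sel op q M i))
        ∎
      where open SetoidReasoning (≐-setoid (suc n))

    old-faces : ∀ {n} q (M : Raw (suc n)) → IsMatroid M →
                concatMap (face sel op q (adjoin M)) (tabulate suc) ≐ negate (adjoinChain (faces sel op (q , M)))
    old-faces {n} q M m = begin
      concatMap (face sel op q (adjoin M)) (tabulate suc)
        ≡⟨ cong concat (map-tabulate-suc (face sel op q (adjoin M))) ⟩
      concatMap (face sel op q (adjoin M) ∘ suc) (allFin (suc n))
        ≈⟨ concatMap-cong (old-face q M m) (allFin (suc n)) ⟩
      concatMap (negate ∘ adjoinChain ∘ face sel op q M) (allFin (suc n))
        ≡⟨ trans (cong negate (map-concatMap _ _ (allFin (suc n)))) (map-concatMap _ _ (allFin (suc n))) ⟨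
      negate (adjoinChain (faces sel op (q , M)))
        ∎
      where open SetoidReasoning (≐-setoid (suc n))

    faces-adjoin₀ : ∀ q (M : Raw 0) → IsMatroid M → faces sel op (q , adjoin M) ≐ select s ((q , M) ∷ [])
    faces-adjoin₀ q M m = begin
      face sel op q (adjoin M) zero ++ []   ≡⟨ ++-identityʳ _ ⟩
      face sel op q (adjoin M) zero         ≈⟨ new-face q M m ⟩
      select s ((q , M) ∷ [])               ∎
      where open SetoidReasoning (≐-setoid 0)

    faces-adjoin : ∀ {n} q (M : Raw (suc n)) → IsMatroid M →
                   faces sel op (q , adjoin M) ++ adjoinChain (faces sel op (q , M)) ≐ select s ((q , M) ∷ [])
    faces-adjoin {n} q M m = begin
      (face sel op q (adjoin M) zero ++ old) ++ F   ≡⟨ ++-assoc (face sel op q (adjoin M) zero) old F ⟩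
      face sel op q (adjoin M) zero ++ (old ++ F)   ≈⟨ ++-cong (new-face q M m) (++-cong (old-faces q M m) ≐-refl) ⟩
      select s ((q , M) ∷ []) ++ (negate F ++ F)    ≈⟨ ++-cong ≐-refl (negate-++-cancel F) ⟩
      select s ((q , M) ∷ []) ++ []                 ≡⟨ ++-identityʳ _ ⟩
      select s ((q , M) ∷ [])                       ∎
      where
      open SetoidReasoning (≐-setoid (suc n))
      old F : Chain (suc n)
      old = concatMap (face sel op q (adjoin M)) (tabulate suc)
      F   = adjoinChain (faces sel op (q , M))

    ∂gen-homotopy : HomotopyIdentity s (∂gen sel op)
    ∂gen-homotopy = record { degree-zero = degree-zero ; degree-suc = degree-suc }
      where
      ∂ : Differential
      ∂ = ∂gen sel op

      degree-zero : ∀ (c : Chain 0) → Supported IsMatroid c → ∂ (adjoinChain c) ≐ select s c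
      degree-zero []            []       = ≐-reflexive (sym (select-[] s))
      degree-zero ((q , M) ∷ c) (m ∷ ms) = begin
        faces sel op (q , adjoin M) ++ ∂ (adjoinChain c)  ≈⟨ ++-cong (faces-adjoin₀ q M m) (degree-zero c ms) ⟩
        select s ((q , M) ∷ []) ++ select s c              ≡⟨ select-++ s ((q , M) ∷ []) c ⟨
        select s ((q , M) ∷ c)                             ∎
        where open SetoidReasoning (≐-setoid 0)

      degree-suc : ∀ {n} (c : Chain (suc n)) → Supported IsMatroid c →
                   ∂ (adjoinChain c) ++ adjoinChain (∂ c) ≐ select s c
      degree-suc []                []       = ≐-reflexive (sym (select-[] s))
      degree-suc {n} ((q , M) ∷ c) (m ∷ ms) = begin
        (F⁺ ++ ∂ (adjoinChain c)) ++ adjoinChain (F ++ ∂ c)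
          ≡⟨ cong ((F⁺ ++ ∂ (adjoinChain c)) ++_) (map-++ (map₂ adjoin) F (∂ c)) ⟩
        (F⁺ ++ ∂ (adjoinChain c)) ++ (adjoinChain F ++ adjoinChain (∂ c))
          ≈⟨ ++-interchange F⁺ _ _ _ ⟩
        (F⁺ ++ adjoinChain F) ++ (∂ (adjoinChain c) ++ adjoinChain (∂ c))
          ≈⟨ ++-cong (faces-adjoin q M m) (degree-suc c ms) ⟩
        select s ((q , M) ∷ []) ++ select s c
          ≡⟨ select-++ s ((q , M) ∷ []) c ⟨
        select s ((q , M) ∷ c)
          ∎
        where
        open SetoidReasoning (≐-setoid (suc n))
        F⁺ : Chain (suc n)
        F⁺ = faces sel op (q , adjoin M)
        F : Chain n
        F  = faces sel op (q , M)

  ++-homotopy : ∀ {s} {∂₁ ∂₂ : Differential} → HomotopyIdentity s ∂₁ → HomotopyIdentity (not s) ∂₂ →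
                HomotopyIdentity true (λ c → ∂₁ c ++ ∂₂ c)
  ++-homotopy {s} {∂₁} {∂₂} H₁ H₂ = record { degree-zero = degree-zero ; degree-suc = degree-suc }
    where
    module H₁ = HomotopyIdentity H₁
    module H₂ = HomotopyIdentity H₂

    degree-zero : ∀ (c : Chain 0) → Supported IsMatroid c → ∂₁ (adjoinChain c) ++ ∂₂ (adjoinChain c) ≐ c
    degree-zero c ms = begin
      ∂₁ (adjoinChain c) ++ ∂₂ (adjoinChain c)   ≈⟨ ++-cong (H₁.degree-zero c ms) (H₂.degree-zero c ms) ⟩
      select s c ++ select (not s) c             ≡⟨ select-complement s c ⟩
      c                                          ∎
      where open SetoidReasoning (≐-setoid 0)

    degree-suc : ∀ {n} (c : Chain (suc n)) → Supported IsMatroid c →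
                 (∂₁ (adjoinChain c) ++ ∂₂ (adjoinChain c)) ++ adjoinChain (∂₁ c ++ ∂₂ c) ≐ c
    degree-suc {n} c ms = begin
      (∂₁ (adjoinChain c) ++ ∂₂ (adjoinChain c)) ++ adjoinChain (∂₁ c ++ ∂₂ c)
        ≡⟨ cong ((∂₁ (adjoinChain c) ++ ∂₂ (adjoinChain c)) ++_) (map-++ (map₂ adjoin) (∂₁ c) (∂₂ c)) ⟩
      (∂₁ (adjoinChain c) ++ ∂₂ (adjoinChain c)) ++ (adjoinChain (∂₁ c) ++ adjoinChain (∂₂ c))
        ≈⟨ ++-interchange (∂₁ (adjoinChain c)) _ _ _ ⟩
      (∂₁ (adjoinChain c) ++ adjoinChain (∂₁ c)) ++ (∂₂ (adjoinChain c) ++ adjoinChain (∂₂ c))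
        ≈⟨ ++-cong (H₁.degree-suc c ms) (H₂.degree-suc c ms) ⟩
      select s c ++ select (not s) c
        ≡⟨ select-complement s c ⟩
      c
        ∎
      where open SetoidReasoning (≐-setoid (suc n))

  acyclic : ∀ {∂ : Differential} (Q : MatroidProperty) → (∀ {n} {M : Raw n} → Q M → IsMatroid M) →
            (∀ {n} {M : Raw n} → Q M → Q (adjoin M)) → HomotopyIdentity true ∂ → Acyclic Q ∂
  acyclic {∂} Q Q⇒matroid Q-adjoin H = boundary₀ , boundary
    where
    open HomotopyIdentity H

    adjoinChain-supported : ∀ {n} {c : Chain n} → Supported Q c → Supported Q (adjoinChain c)
    adjoinChain-supported c∈Q = map⁺ (All.map Q-adjoin c∈Q)

    boundary₀ : ∀ (c : Chain 0) → Supported Q c → ∃ λ (d : Chain 1) → Supported Q d × ∂ d ≈ c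
    boundary₀ c c∈Q = adjoinChain c , adjoinChain-supported c∈Q , [] , λ N →
      trans (cong (_- coeff c N) (coeff-≗ (degree-zero c (All.map Q⇒matroid c∈Q)) N)) (+-inverseʳ (coeff c N))

    boundary : ∀ n (c : Chain (suc n)) → Supported Q c → ∂ c ≈ [] →
               ∃ λ (d : Chain (suc (suc n))) → Supported Q d × ∂ d ≈ c
    boundary n c c∈Q (R , ∂c≈0) = adjoinChain c , adjoinChain-supported c∈Q , liftRelations R , λ N → begin
      coeff (∂ hc) N - coeff c N
        ≡⟨ cong (λ x → coeff (∂ hc) N - x) (coeff-≗ (degree-suc c (All.map Q⇒matroid c∈Q)) N) ⟨
      coeff (∂ hc) N - coeff (∂ hc ++ adjoinChain (∂ c)) N
        ≡⟨ cong (λ x → coeff (∂ hc) N - x) (coeff-++ (∂ hc) (adjoinChain (∂ c)) N) ⟩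
      coeff (∂ hc) N - (coeff (∂ hc) N + coeff (adjoinChain (∂ c)) N)
        ≡⟨ solve 2 (λ a b → a :- (a :+ b) := :- b) refl (coeff (∂ hc) N) _ ⟩
      - coeff (adjoinChain (∂ c)) N
        ≡⟨ cong -_ (coeff-≗ (adjoinChain-cong ∂c≐R) N) ⟩
      - coeff (adjoinChain (relChain R)) N
        ≡⟨ coeff-negate (adjoinChain (relChain R)) N ⟨
      coeff (negate (adjoinChain (relChain R))) N
        ≡⟨ coeff-≗ (relChain-liftRelations R) N ⟨
      coeff (relChain (liftRelations R)) N
        ∎
      where
      open ≡-Reasoning
      hc : Chain (suc (suc n))
      hc = adjoinChain c
      ∂c≐R : ∂ c ≐ relChain R
      ∂c≐R = coeffwise λ N → trans (sym (+-identityʳ (coeff (∂ c) N))) (∂c≈0 N)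

adjoinLoop : Adjoin
adjoinLoop = record
  { adjoin             = addLoop
  ; adjoin-cong        = λ { M≗M′ (b ∷ S) → cong (not b ∧_) (M≗M′ S) }
  ; delete-zero-adjoin = λ _ _ → refl
  ; adjoin-isMatroid   = addLoop-isMatroid
  ; act-lift₀-adjoin   = λ { _ _ (_ ∷ _) → refl }
  }

adjoinColoop : Adjoin
adjoinColoop = record
  { adjoin             = addColoop
  ; adjoin-cong        = λ { M≗M′ (_ ∷ S) → M≗M′ S }
  ; delete-zero-adjoin = λ _ _ → refl
  ; adjoin-isMatroid   = addColoop-isMatroid
  ; act-lift₀-adjoin   = λ { _ _ (_ ∷ _) → refl }
  }

module Loop   = Homotopy adjoinLoop
module Coloop = Homotopy adjoinColoop

n<ᵇn≡false : ∀ n → (n <ᵇ n) ≡ false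
n<ᵇn≡false n = ¬-not (n≮n n ∘ <ᵇ⇒< n n ∘ Equivalence.from T-≡)

n<ᵇ1+n≡true : ∀ n → (n <ᵇ suc n) ≡ true
n<ᵇ1+n≡true n = Equivalence.to T-≡ (<⇒<ᵇ (n<1+n n))

delete-addLoop : ∀ {n} (M : Raw (suc n)) i → delete (suc i) (addLoop M) ≗ addLoop (delete i M)
delete-addLoop M i (_ ∷ _) = refl

delete-addColoop : ∀ {n} (M : Raw (suc n)) i → delete (suc i) (addColoop M) ≗ addColoop (delete i M)
delete-addColoop M i (_ ∷ _) = refl

contract-addLoop : ∀ {n} (M : Raw (suc n)) i → contract (suc i) (addLoop M) ≗ addLoop (contract i M)
contract-addLoop M i (_ ∷ _) with M ⁅ i ⁆
... | true  = refl
... | false = refl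

contract-zero-addColoop : ∀ {n} (M : Raw n) → contract zero (addColoop M) ≗ M
contract-zero-addColoop M S with M Empty
... | true  = refl
... | false = refl

loop-deletion : Loop.Compatible isColoop delete false
loop-deletion = record
  { selects-new = λ M _ → trans (cong (rank M <ᵇ_) (rank-addLoop M)) (n<ᵇn≡false (rank M))
  ; removes-new = λ _ _ → refl
  ; selects-old = λ M i _ →
      cong₂ _<ᵇ_ (trans (rank-cong (delete-addLoop M i)) (rank-addLoop (delete i M))) (rank-addLoop M)
  ; removes-old = delete-addLoop
  }

loop-contraction : Loop.Compatible isLoop contract true
loop-contraction = record
  { selects-new = λ _ _ → refl
  ; removes-new = λ _ _ → refl
  ; selects-old = λ _ _ _ → refl
  ; removes-old = contract-addLoop
  }

coloop-deletion : Coloop.Compatible isColoop delete true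
coloop-deletion = record
  { selects-new = λ M m → trans (cong (rank M <ᵇ_) (rank-addColoop M (empty-indep m))) (n<ᵇ1+n≡true (rank M))
  ; removes-new = λ _ _ → refl
  ; selects-old = λ M i m →
      cong₂ _<ᵇ_ (trans (rank-cong (delete-addColoop M i))
                        (rank-addColoop (delete i M) (trans (cong M (insertAt-Empty i)) (empty-indep m))))
                 (rank-addColoop M (empty-indep m))
  ; removes-old = delete-addColoop
  }
  where open IsMatroid

coloop-contraction : Coloop.Compatible isLoop contract false
coloop-contraction = record
  { selects-new = λ M m → cong not (IsMatroid.empty-indep m)
  ; removes-new = contract-zero-addColoop
  ; selects-old = λ _ _ _ → refl
  ; removes-old = λ { _ _ (_ ∷ _) → refl }
  }

adjoinLoop-∂del : Loop.HomotopyIdentity true ∂del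
adjoinLoop-∂del = Loop.∂gen-homotopy (Loop.complement loop-deletion)

adjoinLoop-∂clp : Loop.HomotopyIdentity false ∂clp
adjoinLoop-∂clp = Loop.∂gen-homotopy loop-deletion

adjoinLoop-∂lp : Loop.HomotopyIdentity true ∂lp
adjoinLoop-∂lp = Loop.∂gen-homotopy loop-contraction

adjoinLoop-∂con : Loop.HomotopyIdentity false ∂con
adjoinLoop-∂con = Loop.∂gen-homotopy (Loop.complement loop-contraction)

adjoinColoop-∂del : Coloop.HomotopyIdentity false ∂del
adjoinColoop-∂del = Coloop.∂gen-homotopy (Coloop.complement coloop-deletion)

adjoinColoop-∂clp : Coloop.HomotopyIdentity true ∂clp
adjoinColoop-∂clp = Coloop.∂gen-homotopy coloop-deletion

adjoinColoop-∂lp : Coloop.HomotopyIdentity false ∂lp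
adjoinColoop-∂lp = Coloop.∂gen-homotopy coloop-contraction

adjoinColoop-∂con : Coloop.HomotopyIdentity true ∂con
adjoinColoop-∂con = Coloop.∂gen-homotopy (Coloop.complement coloop-contraction)

module _ {P : MatroidProperty} where

  acyclic-loopSum : LoopSumClosed P → ∀ {∂ : Differential} → Loop.HomotopyIdentity true ∂ →
                    Acyclic (MP P) ∂ × (∀ r → Acyclic (MPrank P r) ∂)
  acyclic-loopSum L H =
    Loop.acyclic (MP P) proj₁ MP-addLoop H ,
    λ r → Loop.acyclic (MPrank P r) (proj₁ ∘ proj₁) MPrank-addLoop H
    where
    MP-addLoop : ∀ {n} {M : Raw n} → MP P M → MP P (addLoop M)
    MP-addLoop (m , p) = addLoop-isMatroid m , L _ m p
    MPrank-addLoop : ∀ {r n} {M : Raw n} → MPrank P r M → MPrank P r (addLoop M)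
    MPrank-addLoop {M = M} (M∈P , rank≡r) = MP-addLoop M∈P , trans (rank-addLoop M) rank≡r

  acyclic-coloopSum : ColoopSumClosed P → ∀ {∂ : Differential} → Coloop.HomotopyIdentity true ∂ →
                      Acyclic (MP P) ∂ × (∀ k → Acyclic (MPnul P k) ∂)
  acyclic-coloopSum C H =
    Coloop.acyclic (MP P) proj₁ MP-addColoop H ,
    λ k → Coloop.acyclic (MPnul P k) (proj₁ ∘ proj₁) MPnul-addColoop H
    where
    MP-addColoop : ∀ {n} {M : Raw n} → MP P M → MP P (addColoop M)
    MP-addColoop (m , p) = addColoop-isMatroid m , C _ m p
    MPnul-addColoop : ∀ {k n} {M : Raw n} → MPnul P k M → MPnul P k (addColoop M)
    MPnul-addColoop {n = n} {M} ((m , p) , nullity≡k) =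
      MP-addColoop (m , p) , trans (cong (suc n ∸_) (rank-addColoop M (IsMatroid.empty-indep m))) nullity≡k

-- Closure under deletion or contraction only makes 𝓜^P a subcomplex of 𝓜.
corollary5p15 : (P : MatroidProperty) → IsoStable P →
    (DeletionClosed P → LoopSumClosed P →
      Acyclic (MP P) ∂deltot × Acyclic (MP P) ∂del ×
      (∀ (r : ℕ) → Acyclic (MPrank P r) ∂del)) ×
    (ContractionClosed P → LoopSumClosed P →
      Acyclic (MP P) ∂contot × Acyclic (MP P) ∂lp ×
      (∀ (r : ℕ) → Acyclic (MPrank P r) ∂lp)) ×
    (DeletionClosed P → ColoopSumClosed P →
      Acyclic (MP P) ∂deltot × Acyclic (MP P) ∂clp ×
      (∀ (k : ℕ) → Acyclic (MPnul P k) ∂clp)) ×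
    (ContractionClosed P → ColoopSumClosed P →
      Acyclic (MP P) ∂contot × Acyclic (MP P) ∂con ×
      (∀ (k : ℕ) → Acyclic (MPnul P k) ∂con))
corollary5p15 P _ =
  (λ _ L → proj₁ (acyclic-loopSum L (Loop.++-homotopy adjoinLoop-∂del adjoinLoop-∂clp))
         , acyclic-loopSum L adjoinLoop-∂del) ,
  (λ _ L → proj₁ (acyclic-loopSum L (Loop.++-homotopy adjoinLoop-∂lp adjoinLoop-∂con))
         , acyclic-loopSum L adjoinLoop-∂lp) ,
  (λ _ C → proj₁ (acyclic-coloopSum C (Coloop.++-homotopy adjoinColoop-∂del adjoinColoop-∂clp))
         , acyclic-coloopSum C adjoinColoop-∂clp) ,
  (λ _ C → proj₁ (acyclic-coloopSum C (Coloop.++-homotopy adjoinColoop-∂lp adjoinColoop-∂con))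
         , acyclic-coloopSum C adjoinColoop-∂con)
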